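{- Let $k\ge 2$, $q\ge 1$, $n\ge k$ be integers and $N=N_k(q,n)$. Then for every transitive coloring of all $k$-element subsets of $[N]$ with $q$ colors there is an $n$-element subset of $[N]$ all of whose $k$-element subsets receive the same color.
   Context: A monotone path of length $n$ in the complete $k$-uniform hypergraph on $[N]$ is given by integers $j_1<\dots<j_n$ with the $k$-sets $\{j_i,\dots,j_{i+k-1}\}$, $i=1,\dots,n-k+1$. $N_k(q,n)$ is the smallest $N$ such that every $q$-coloring of the $k$-subsets of $[N]$ contains a monotone path of length $n$ whose $k$-sets all have the same color. A family $\mathcal F$ of $k$-subsets of $[N]$ is transitive if for all $i_1<\dots<i_{k+1}$ in $[N]$ with $\{i_1,\dots,i_k\},\{i_2,\dots,i_{k+1}\}\in\mathcal F$, every $k$-subset of $\{i_1,\dots,i_{k+1}\}$ belongs to $\mathcal F$. A $q$-coloring of the $k$-subsets of $[N]$ is transitive if each color class is transitive. -}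

module Defs where

open import Data.Nat as ℕ using (ℕ; zero; suc; _+_; _≤_)
open import Data.Nat.Properties using (+-monoʳ-<; <-≤-trans)
open import Data.Fin as Fin using (Fin; toℕ; fromℕ<; fromℕ)
open import Data.Fin.Properties using (toℕ<n)
open import Data.Vec using (Vec; lookup; tabulate; map; removeAt)
open import Data.Product using (Σ; _×_; ∃; ∃-syntax)
open import Relation.Binary.PropositionalEquality using (_≡_)
open import Relation.Nullary using (¬_)

-- [N] is represented by Fin N.  A k-element subset of [N] is represented by
-- its increasing enumeration, a strictly increasing vector in Vec (Fin N) k.
Increasing : ∀ {m N} → Vec (Fin N) m → Set
Increasing {m} v = (i j : Fin m) → i Fin.< j → lookup v i Fin.< lookup v j

-- A q-coloring of the k-subsets of [N]: a map on k-vectors; only its values on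
-- increasing vectors (= k-subsets) are ever used.
Coloring : ℕ → ℕ → ℕ → Set
Coloring k q N = Vec (Fin N) k → Fin q

private
  win-lemma : ∀ {k n} (i : ℕ) → i + k ≤ n → (t : Fin k) → i + toℕ t ℕ.< n
  win-lemma i p t = <-≤-trans (+-monoʳ-< i (toℕ<n t)) p

-- The i-th edge {j_i, ..., j_{i+k-1}} (0-based) of the monotone path j.
window : ∀ {N n} (k : ℕ) → Vec (Fin N) n → (i : ℕ) → i + k ≤ n → Vec (Fin N) k
window k j i p = tabulate (λ t → lookup j (fromℕ< (win-lemma i p t)))

PathRamsey : ℕ → ℕ → ℕ → ℕ → Set
PathRamsey k q n N =
  (c : Coloring k q N) →
  ∃[ j ] (Increasing {n} j ×
    ∃[ a ] ((i : ℕ) (p : i + k ≤ n) → c (window k j i p) ≡ a))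

IsNk : ℕ → ℕ → ℕ → ℕ → Set
IsNk k q n N = PathRamsey k q n N × ((M : ℕ) → M ℕ.< N → ¬ PathRamsey k q n M)

-- For i_1<...<i_{k+1}
-- (an increasing (k+1)-vector v), {i_1..i_k} = v without its last entry,
-- {i_2..i_{k+1}} = v without its first entry, and the k-subsets of v are the
-- vectors obtained by removing one entry.
TransitiveColoring : ∀ {k q N} → Coloring k q N → Set
TransitiveColoring {k} {q} {N} c =
  (a : Fin q) (v : Vec (Fin N) (suc k)) → Increasing v →
  c (removeAt v (fromℕ k)) ≡ a → c (removeAt v Fin.zero) ≡ a →
  (r : Fin (suc k)) → c (removeAt v r) ≡ a

-- An n-subset (increasing vector v) all of whose k-subsets get color a.
-- A k-subset of v is v ∘ s for an increasing s : Vec (Fin n) k.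
MonoSubset : ∀ {k q N} (n : ℕ) → Coloring k q N → Set
MonoSubset {k} {q} {N} n c =
  ∃[ v ] (Increasing {n} {N} v ×
    ∃[ a ] ((s : Vec (Fin n) k) → Increasing s → c (map (lookup v) s) ≡ a))

-- Let j_0 < ... < j_{n-1} be a monotone path whose windows {j_i, ..., j_{i+k-1}}
-- all have colour a under a transitive colouring c.  We show that every k-subset
-- of {j_0, ..., j_{n-1}} has colour a; applied to the path that N = N_k(q,n)
-- provides, this is the theorem.  A k-subset is described by the increasing
-- vector s of its positions in the path, and we argue by induction on the
-- spread hi s - lo s of s (its last minus its first position):
--   * if s is a run of consecutive positions, it is a window of the path;
--   * otherwise s has a gap, and filling one missing position of the gap gives an
--     increasing (k+1)-vector w with the same endpoints as s (an Extension of s).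
--     Dropping the last or the first entry of w strictly decreases the spread, so
--     both have colour a by induction, and transitivity colours every k-subset of
--     w with a, in particular s = w with the filled position removed.  The argument works for
-- every k ≥ 1; of the hypotheses of the theorem only k ≠ 0 is used.
module Submission where

open import Defs
open import Data.Nat using (ℕ; _≤_)
open import Data.Nat using (zero; suc; _+_; _<_; z≤n; s≤s; s≤s⁻¹)
open import Data.Nat.Properties
open import Data.Fin as Fin using (Fin; zero; suc; toℕ; fromℕ; fromℕ<; inject₁; punchIn; punchOut)
open import Data.Fin.Properties
  using (toℕ-injective; toℕ-fromℕ; toℕ-fromℕ<; toℕ-inject₁; toℕ<n;
         punchInᵢ≢i; punchIn-mono-≤; punchIn-cancel-≤; punchIn-punchOut; punchOut-punchIn)
open import Data.Vec using (Vec; []; _∷_; lookup; map; insertAt; removeAt)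
open import Data.Vec.Properties
  using (lookup-map; lookup∘tabulate; insertAt-lookup; insertAt-punchIn; removeAt-insertAt; removeAt-punchOut)
open import Data.Vec.Relation.Binary.Pointwise.Extensional using (ext; Pointwise-≡⇒≡)
open import Data.Product using (∃; _,_)
open import Data.Sum using (_⊎_; inj₁; inj₂)
open import Data.Empty using (⊥-elim)
open import Relation.Binary.PropositionalEquality
open import Relation.Nullary using (yes; no)
open import Function using (_∘_)

lookup-ext : ∀ {A : Set} {r} {u w : Vec A r} → (∀ i → lookup u i ≡ lookup w i) → u ≡ w
lookup-ext same = Pointwise-≡⇒≡ (ext same)

punchIn-≥ : ∀ {r} (p : Fin (suc r)) (i : Fin r) → toℕ i ≤ toℕ (punchIn p i)
punchIn-≥ zero    i       = n≤1+n (toℕ i)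
punchIn-≥ (suc p) zero    = z≤n
punchIn-≥ (suc p) (suc i) = s≤s (punchIn-≥ p i)

punchIn-≤ : ∀ {r} (p : Fin (suc r)) (i : Fin r) → toℕ (punchIn p i) ≤ suc (toℕ i)
punchIn-≤ zero    i       = ≤-refl
punchIn-≤ (suc p) zero    = z≤n
punchIn-≤ (suc p) (suc i) = s≤s (punchIn-≤ p i)

punchIn-mono-< : ∀ {r} (p : Fin (suc r)) (i i' : Fin r) → i Fin.< i' → punchIn p i Fin.< punchIn p i'
punchIn-mono-< p i i' i<i' = ≰⇒> (<⇒≱ i<i' ∘ punchIn-cancel-≤ p i' i)

punchIn-cancel-< : ∀ {r} (p : Fin (suc r)) (i i' : Fin r) → punchIn p i Fin.< punchIn p i' → i Fin.< i'
punchIn-cancel-< p i i' lt = ≰⇒> (<⇒≱ lt ∘ punchIn-mono-≤ p i' i)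

toℕ-punchIn-fromℕ : ∀ r (i : Fin r) → toℕ (punchIn (fromℕ r) i) ≡ toℕ i
toℕ-punchIn-fromℕ (suc r) zero    = refl
toℕ-punchIn-fromℕ (suc r) (suc i) = cong suc (toℕ-punchIn-fromℕ r i)

punchIn-inject₁-fromℕ : ∀ r (p : Fin (suc r)) → punchIn (inject₁ p) (fromℕ r) ≡ fromℕ (suc r)
punchIn-inject₁-fromℕ r       zero    = refl
punchIn-inject₁-fromℕ (suc r) (suc p) = cong suc (punchIn-inject₁-fromℕ r p)

punchIn-cover : ∀ {r} (p r' : Fin (suc r)) → p ≡ r' ⊎ ∃ λ i → punchIn p i ≡ r'
punchIn-cover p r' with p Fin.≟ r'
... | yes p≡r' = inj₁ p≡r'
... | no  p≢r' = inj₂ (punchOut p≢r' , punchIn-punchOut p≢r')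

lookup-removeAt : ∀ {A : Set} {r} (xs : Vec A (suc r)) (p : Fin (suc r)) (i : Fin r) →
  lookup (removeAt xs p) i ≡ lookup xs (punchIn p i)
lookup-removeAt xs p i =
  trans (cong (lookup (removeAt xs p)) (sym (punchOut-punchIn p)))
        (removeAt-punchOut xs (punchInᵢ≢i p i ∘ sym))

map-removeAt : ∀ {A B : Set} {r} (f : A → B) (xs : Vec A (suc r)) (p : Fin (suc r)) →
  map f (removeAt xs p) ≡ removeAt (map f xs) p
map-removeAt f (x ∷ xs)     zero    = refl
map-removeAt f (x ∷ y ∷ xs) (suc p) = cong (f x ∷_) (map-removeAt f (y ∷ xs) p)

increasing-≤ : ∀ {r N} (s : Vec (Fin N) r) → Increasing s →
  ∀ i i' → i Fin.≤ i' → lookup s i Fin.≤ lookup s i'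
increasing-≤ s s-inc i i' i≤i' with m≤n⇒m<n∨m≡n i≤i'
... | inj₁ i<i' = <⇒≤ (s-inc i i' i<i')
... | inj₂ i≡i' rewrite toℕ-injective i≡i' = ≤-refl

removeAt-increasing : ∀ {r N} (s : Vec (Fin N) (suc r)) → Increasing s → ∀ p → Increasing (removeAt s p)
removeAt-increasing s s-inc p i i' i<i'
  rewrite lookup-removeAt s p i | lookup-removeAt s p i' = s-inc _ _ (punchIn-mono-< p i i' i<i')

map-increasing : ∀ {r n N} (j : Vec (Fin N) n) (s : Vec (Fin n) r) →
  Increasing j → Increasing s → Increasing (map (lookup j) s)
map-increasing j s j-inc s-inc i i' i<i'
  rewrite lookup-map i (lookup j) s | lookup-map i' (lookup j) s = j-inc _ _ (s-inc i i' i<i')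

insertAt-increasing : ∀ {r N} (s : Vec (Fin N) r) → Increasing s → ∀ p x →
  (∀ i → i Fin.< p → lookup s i Fin.< x) → (∀ i → p Fin.≤ i → x Fin.< lookup s i) →
  Increasing (insertAt s p x)
insertAt-increasing s s-inc p x below above r r' r<r' with punchIn-cover p r | punchIn-cover p r'
... | inj₁ refl | inj₁ refl = ⊥-elim (<-irrefl refl r<r')
... | inj₁ refl | inj₂ (i' , refl) rewrite insertAt-lookup s p x | insertAt-punchIn s p x i' =
  above i' (s≤s⁻¹ (<-≤-trans r<r' (punchIn-≤ p i')))
... | inj₂ (i , refl) | inj₁ refl rewrite insertAt-punchIn s p x i | insertAt-lookup s p x =
  below i (≤-<-trans (punchIn-≥ p i) r<r')
... | inj₂ (i , refl) | inj₂ (i' , refl) rewrite insertAt-punchIn s p x i | insertAt-punchIn s p x i' =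
  s-inc i i' (punchIn-cancel-< p i i' r<r')

lo : ∀ {n r} → Vec (Fin n) (suc r) → ℕ
lo s = toℕ (lookup s zero)

hi : ∀ {n r} → Vec (Fin n) (suc r) → ℕ
hi {r = r} s = toℕ (lookup s (fromℕ r))

lo≤hi : ∀ {n r} (s : Vec (Fin n) (suc r)) → Increasing s → lo s ≤ hi s
lo≤hi s s-inc = increasing-≤ s s-inc zero _ z≤n

removeAt-last-lo : ∀ {n r} (w : Vec (Fin n) (suc (suc r))) → lo (removeAt w (fromℕ (suc r))) ≡ lo w
removeAt-last-lo (x ∷ y ∷ ys) = refl

removeAt-last-hi : ∀ {n r} (w : Vec (Fin n) (suc (suc r))) → Increasing w →
  hi (removeAt w (fromℕ (suc r))) < hi w
removeAt-last-hi {r = r} w w-inc rewrite lookup-removeAt w (fromℕ (suc r)) (fromℕ r) = w-inc _ _ below-top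
  where
  below-top : toℕ (punchIn (fromℕ (suc r)) (fromℕ r)) < toℕ (fromℕ (suc r))
  below-top rewrite toℕ-punchIn-fromℕ (suc r) (fromℕ r) | toℕ-fromℕ r = n<1+n r

removeAt-zero-lo : ∀ {n r} (w : Vec (Fin n) (suc (suc r))) → Increasing w → lo w < lo (removeAt w zero)
removeAt-zero-lo (x ∷ y ∷ ys) w-inc = w-inc zero (suc zero) (s≤s z≤n)

removeAt-zero-hi : ∀ {n r} (w : Vec (Fin n) (suc (suc r))) → hi (removeAt w zero) ≡ hi w
removeAt-zero-hi (x ∷ xs) = refl

IsRun : ∀ {n r} → Vec (Fin n) (suc r) → Set
IsRun s = ∀ t → toℕ (lookup s t) ≡ lo s + toℕ t

GapAt : ∀ {n r} → Vec (Fin n) (suc r) → Fin r → Set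
GapAt s t = suc (toℕ (lookup s (inject₁ t))) < toℕ (lookup s (suc t))

run-or-gap : ∀ {n r} (s : Vec (Fin n) (suc r)) → Increasing s → IsRun s ⊎ ∃ (GapAt s)
run-or-gap (x ∷ []) s-inc = inj₁ λ { zero → sym (+-identityʳ (toℕ x)) }
run-or-gap (x ∷ y ∷ ys) s-inc with run-or-gap (y ∷ ys) (removeAt-increasing (x ∷ y ∷ ys) s-inc zero)
... | inj₂ (t , gap) = inj₂ (suc t , gap)
... | inj₁ run with m≤n⇒m<n∨m≡n (s-inc zero (suc zero) (s≤s z≤n))
...   | inj₁ gap      = inj₂ (zero , gap)
...   | inj₂ adjacent = inj₁ λ { zero → sym (+-identityʳ (toℕ x)) ; (suc t) → shifted t }
  where
  shifted : ∀ t → toℕ (lookup (y ∷ ys) t) ≡ toℕ x + suc (toℕ t)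
  shifted t = begin
    toℕ (lookup (y ∷ ys) t) ≡⟨ run t ⟩
    toℕ y + toℕ t           ≡⟨ cong (_+ toℕ t) (sym adjacent) ⟩
    suc (toℕ x) + toℕ t     ≡⟨ sym (+-suc (toℕ x) (toℕ t)) ⟩
    toℕ x + suc (toℕ t)     ∎
    where open ≡-Reasoning

record Extension {n r} (s : Vec (Fin n) (suc r)) : Set where
  field
    vec           : Vec (Fin n) (suc (suc r))
    increasing    : Increasing vec
    hole          : Fin (suc (suc r))
    removeAt-hole : removeAt vec hole ≡ s
    same-lo       : lo vec ≡ lo s
    same-hi       : hi vec ≡ hi s

insertAt-suc-head : ∀ {A : Set} {r} (s : Vec A (suc r)) (p : Fin (suc r)) (x : A) →
  lookup (insertAt s (suc p) x) zero ≡ lookup s zero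
insertAt-suc-head (y ∷ ys) p x = refl

fill-gap : ∀ {n r} (s : Vec (Fin n) (suc r)) → Increasing s → (t : Fin r) → GapAt s t → Extension s
fill-gap {n} {r} s s-inc t gap = record
  { vec           = insertAt s hole x
  ; increasing    = insertAt-increasing s s-inc hole x below above
  ; hole          = hole
  ; removeAt-hole = removeAt-insertAt s hole x
  ; same-lo       = cong toℕ (insertAt-suc-head s (inject₁ t) x)
  ; same-hi       = cong toℕ top-kept
  }
  where
  hole : Fin (suc (suc r))
  hole = suc (inject₁ t)

  x<n : suc (toℕ (lookup s (inject₁ t))) < n
  x<n = <-trans gap (toℕ<n (lookup s (suc t)))

  x : Fin n
  x = fromℕ< x<n

  toℕ-x : toℕ x ≡ suc (toℕ (lookup s (inject₁ t)))
  toℕ-x = toℕ-fromℕ< x<n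

  below : ∀ i → i Fin.< hole → lookup s i Fin.< x
  below i i<hole rewrite toℕ-x = s≤s (increasing-≤ s s-inc i (inject₁ t) (s≤s⁻¹ i<hole))

  above : ∀ i → hole Fin.≤ i → x Fin.< lookup s i
  above i hole≤i rewrite toℕ-x = <-≤-trans gap (increasing-≤ s s-inc (suc t) i after-t)
    where
    after-t : suc t Fin.≤ i
    after-t = subst (λ z → suc z ≤ toℕ i) (toℕ-inject₁ t) hole≤i

  -- The last entry is untouched, since the hole lies below the top index.
  top-kept : lookup (insertAt s hole x) (fromℕ (suc r)) ≡ lookup s (fromℕ r)
  top-kept = begin
    lookup (insertAt s hole x) (fromℕ (suc r))           ≡⟨ cong (lookup (insertAt s hole x)) moved-top ⟩
    lookup (insertAt s hole x) (punchIn hole (fromℕ r)) ≡⟨ insertAt-punchIn s hole x (fromℕ r) ⟩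
    lookup s (fromℕ r)                                   ∎
    where
    open ≡-Reasoning
    moved-top : fromℕ (suc r) ≡ punchIn hole (fromℕ r)
    moved-top = sym (punchIn-inject₁-fromℕ r (suc t))

module _ {n r} {s : Vec (Fin n) (suc r)} (e : Extension s) where
  open Extension e
  open ≤-Reasoning

  drop-last : Vec (Fin n) (suc r)
  drop-last = removeAt vec (fromℕ (suc r))

  drop-first : Vec (Fin n) (suc r)
  drop-first = removeAt vec zero

  extension-lo<hi : lo s < hi s
  extension-lo<hi = begin-strict
    lo s         ≡⟨ sym (trans (removeAt-last-lo vec) same-lo) ⟩
    lo drop-last ≤⟨ lo≤hi drop-last (removeAt-increasing vec increasing _) ⟩
    hi drop-last <⟨ removeAt-last-hi vec increasing ⟩
    hi vec       ≡⟨ same-hi ⟩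
    hi s         ∎

  drop-last-spread : ∀ d → hi s ≤ lo s + suc d → hi drop-last ≤ lo drop-last + d
  drop-last-spread d spread = s≤s⁻¹ (begin-strict
    hi drop-last           <⟨ removeAt-last-hi vec increasing ⟩
    hi vec                 ≡⟨ same-hi ⟩
    hi s                   ≤⟨ spread ⟩
    lo s + suc d           ≡⟨ +-suc (lo s) d ⟩
    suc (lo s + d)         ≡⟨ cong (λ l → suc (l + d)) (sym (trans (removeAt-last-lo vec) same-lo)) ⟩
    suc (lo drop-last + d) ∎)

  drop-first-spread : ∀ d → hi s ≤ lo s + suc d → hi drop-first ≤ lo drop-first + d
  drop-first-spread d spread = begin
    hi drop-first     ≡⟨ trans (removeAt-zero-hi vec) same-hi ⟩
    hi s              ≤⟨ spread ⟩
    lo s + suc d      ≡⟨ +-suc (lo s) d ⟩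
    suc (lo s) + d    ≡⟨ cong (λ l → suc l + d) (sym same-lo) ⟩
    suc (lo vec) + d  ≤⟨ +-monoˡ-≤ d (removeAt-zero-lo vec increasing) ⟩
    lo drop-first + d ∎

module MonochromaticPath {N n m q} (c : Coloring (suc m) q N) (c-trans : TransitiveColoring c)
  (j : Vec (Fin N) n) (j-inc : Increasing j) (a : Fin q)
  (windows : ∀ i (p : i + suc m ≤ n) → c (window (suc m) j i p) ≡ a) where

  colour : Vec (Fin n) (suc m) → Fin q
  colour s = c (map (lookup j) s)

  -- A run of positions is a window of the path.
  run-coloured : ∀ s → IsRun s → colour s ≡ a
  run-coloured s run = trans (cong c (lookup-ext entry)) (windows (lo s) fits)
    where
    last-position : toℕ (lookup s (fromℕ m)) ≡ lo s + m
    last-position = trans (run (fromℕ m)) (cong (lo s +_) (toℕ-fromℕ m))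

    fits : lo s + suc m ≤ n
    fits = subst (_≤ n) (trans (cong suc last-position) (sym (+-suc (lo s) m))) (toℕ<n (lookup s (fromℕ m)))

    within : ∀ t → lo s + toℕ t < n
    within t = <-≤-trans (+-monoʳ-< (lo s) (toℕ<n t)) fits

    entry : ∀ t → lookup (map (lookup j) s) t ≡ lookup (window (suc m) j (lo s) fits) t
    entry t = begin
      lookup (map (lookup j) s) t             ≡⟨ lookup-map t (lookup j) s ⟩
      lookup j (lookup s t)                   ≡⟨ cong (lookup j) (toℕ-injective same-position) ⟩
      lookup j (fromℕ< (within t))            ≡⟨ sym (lookup∘tabulate (λ u → lookup j (fromℕ< (within u))) t) ⟩
      lookup (window (suc m) j (lo s) fits) t ∎
      where
      open ≡-Reasoning
      same-position : toℕ (lookup s t) ≡ toℕ (fromℕ< (within t))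
      same-position = trans (run t) (sym (toℕ-fromℕ< (within t)))

  transitivity : ∀ w → Increasing w →
    colour (removeAt w (fromℕ (suc m))) ≡ a → colour (removeAt w zero) ≡ a →
    ∀ r → colour (removeAt w r) ≡ a
  transitivity w w-inc last-a first-a r =
    trans (cong c (map-removeAt (lookup j) w r))
          (c-trans a (map (lookup j) w) (map-increasing j w j-inc w-inc) (moved last-a) (moved first-a) r)
    where
    moved : ∀ {p} → colour (removeAt w p) ≡ a → c (removeAt (map (lookup j) w) p) ≡ a
    moved {p} = trans (cong c (sym (map-removeAt (lookup j) w p)))

  -- Induction on a bound d for the spread hi s - lo s: runs are windows, and
  -- any other s has an extension, whose two end-removals have smaller spread.
  spread-coloured : ∀ d s → Increasing s → hi s ≤ lo s + d → colour s ≡ a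
  extension-coloured : ∀ d {s} → Extension s → hi s ≤ lo s + d → colour s ≡ a

  spread-coloured d s s-inc spread with run-or-gap s s-inc
  ... | inj₁ run       = run-coloured s run
  ... | inj₂ (t , gap) = extension-coloured d (fill-gap s s-inc t gap) spread

  extension-coloured zero {s} e spread =
    ⊥-elim (<⇒≱ (extension-lo<hi e) (subst (hi s ≤_) (+-identityʳ (lo s)) spread))
  extension-coloured (suc d) {s} e spread = begin
    colour s                   ≡⟨ cong colour (sym removeAt-hole) ⟩
    colour (removeAt vec hole) ≡⟨ transitivity vec increasing last-a first-a hole ⟩
    a                          ∎
    where
    open Extension e
    open ≡-Reasoning
    last-a : colour (drop-last e) ≡ a
    last-a = spread-coloured d _ (removeAt-increasing vec increasing _) (drop-last-spread e d spread)
    first-a : colour (drop-first e) ≡ a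
    first-a = spread-coloured d _ (removeAt-increasing vec increasing _) (drop-first-spread e d spread)

  subsets-coloured : ∀ s → Increasing s → colour s ≡ a
  subsets-coloured s s-inc = spread-coloured (hi s) s s-inc (m≤n+m (hi s) (lo s))

lemma7 : (k q n : ℕ) → 2 ≤ k → 1 ≤ q → k ≤ n →
    (N : ℕ) → IsNk k q n N →
    (c : Coloring k q N) → TransitiveColoring c → MonoSubset n c
lemma7 zero    q n () _ _ N _ c c-trans
lemma7 (suc m) q n _  _ _ N (path-ramsey , _) c c-trans with path-ramsey c
... | j , j-inc , a , windows =
  j , j-inc , a , MonochromaticPath.subsets-coloured c c-trans j j-inc a windows
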